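{- The automorphism group of any oriented Fano plane $(\mathcal{F},\rightarrow)$ is isomorphic to the Frobenius group $F_{21}$ of order $21$ (the unique non-abelian group of order 21).
   Context: A Fano plane is a pair $(\mathcal{V},\mathcal{B})$ with $|\mathcal{V}|=7$ and $\mathcal{B}$ a collection of 3-subsets (blocks) such that every 2-subset lies in exactly one block; an automorphism is a permutation $\sigma$ of $\mathcal{V}$ with $T\in\mathcal{B}$ iff $\sigma(T)\in\mathcal{B}$. An orientation on $\mathcal{F}$ is an antisymmetric binary relation $\rightarrow$ on $\mathcal{V}$ such that (i) for every block $\{x_1,x_2,x_3\}$, either $x_1\rightarrow x_2\rightarrow x_3\rightarrow x_1$ or $x_1\rightarrow x_3\rightarrow x_2\rightarrow x_1$; (ii) for every $x$, if $\{x,y_i,z_i\}$ ($i=1,2,3$) are the three blocks through $x$ and $x\rightarrow y_i$ for all $i$, then $\{y_1,y_2,y_3\}\in\mathcal{B}$. An oriented Fano plane is a pair $(\mathcal{F},\rightarrow)$ with $\rightarrow$ an orientation on $\mathcal{F}$; its automorphisms are the automorphisms $\sigma$ of $\mathcal{F}$ such that $\sigma(x)\rightarrow\sigma(y)$ iff $x\rightarrow y$, for all $x,y\in\mathcal{V}$. -}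

module Defs where

open import Level using (0ℓ)
open import Data.Nat using (ℕ; _+_; _*_; _^_)
open import Data.Nat.DivMod using (_mod_)
open import Data.Fin using (Fin; toℕ)
open import Data.Fin.Subset using (Subset; ⁅_⁆; _∪_; _∈_; ∣_∣)
open import Data.Fin.Permutation using (Permutation′; _⟨$⟩ʳ_; _⟨$⟩ˡ_)
open import Data.Vec using (tabulate; lookup)
open import Data.Product using (Σ; _×_; _,_; ∃; ∃!; proj₁)
open import Data.Sum using (_⊎_)
open import Function.Bundles using (_⇔_)
open import Relation.Nullary using (¬_)
open import Relation.Binary.PropositionalEquality using (_≡_; _≢_)

V : Set
V = Fin 7

triple : V → V → V → Subset 7
triple x y z = ⁅ x ⁆ ∪ (⁅ y ⁆ ∪ ⁅ z ⁆)

record FanoPlane : Set₁ where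
  field
    B          : Subset 7 → Set
    block-size : ∀ T → B T → ∣ T ∣ ≡ 3
    pair-block : ∀ x y → x ≢ y →
                 ∃! _≡_ (λ T → B T × x ∈ T × y ∈ T)

-- Orientation on a Fano plane.
-- "antisymmetric" is read as: never both x → y and y → x
-- (in particular no loops), as for oriented graphs.
record Orientation (F : FanoPlane) : Set₁ where
  open FanoPlane F
  field
    _⇒_    : V → V → Set
    asym   : ∀ x y → x ⇒ y → ¬ (y ⇒ x)
    cyclic : ∀ x₁ x₂ x₃ → B (triple x₁ x₂ x₃) →
             (x₁ ⇒ x₂ × x₂ ⇒ x₃ × x₃ ⇒ x₁) ⊎ (x₁ ⇒ x₃ × x₃ ⇒ x₂ × x₂ ⇒ x₁)
    out-block : ∀ x y₁ z₁ y₂ z₂ y₃ z₃ →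
             B (triple x y₁ z₁) → B (triple x y₂ z₂) → B (triple x y₃ z₃) →
             triple x y₁ z₁ ≢ triple x y₂ z₂ →
             triple x y₁ z₁ ≢ triple x y₃ z₃ →
             triple x y₂ z₂ ≢ triple x y₃ z₃ →
             x ⇒ y₁ → x ⇒ y₂ → x ⇒ y₃ →
             B (triple y₁ y₂ y₃)

image : Permutation′ 7 → Subset 7 → Subset 7
image σ T = tabulate (λ i → lookup T (σ ⟨$⟩ˡ i))

IsAut : (F : FanoPlane) → Orientation F → Permutation′ 7 → Set
IsAut F O σ =
  (∀ T → B T ⇔ B (image σ T)) ×
  (∀ x y → (x ⇒ y) ⇔ ((σ ⟨$⟩ʳ x) ⇒ (σ ⟨$⟩ʳ y)))
  where open FanoPlane F
        open Orientation O

Aut : (F : FanoPlane) → Orientation F → Set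
Aut F O = Σ (Permutation′ 7) (IsAut F O)

-- The Frobenius group F₂₁ = Z₇ ⋊ Z₃, realised as the affine maps
-- x ↦ 2^k x + b of Z/7 (k ∈ Z/3, b ∈ Z/7); (k , b) ∙ (k' , b') is the
-- composite map x ↦ 2^k (2^k' x + b') + b.
F21 : Set
F21 = Fin 3 × Fin 7

_∙F_ : F21 → F21 → F21
(k , b) ∙F (k' , b') =
  ((toℕ k + toℕ k') mod 3) , ((2 ^ toℕ k * toℕ b' + toℕ b) mod 7)

-- A group isomorphism Aut(F , ⇒) ≅ F₂₁: a bijective homomorphism,
-- where automorphisms are compared pointwise and the product in Aut is
-- composition of maps ((σ τ)(x) = σ (τ x)).
record AutIsoF21 (F : FanoPlane) (O : Orientation F) : Set where
  field
    φ    : Aut F O → F21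
    hom  : ∀ (σ τ ρ : Aut F O) →
           (∀ x → proj₁ ρ ⟨$⟩ʳ x ≡ proj₁ σ ⟨$⟩ʳ (proj₁ τ ⟨$⟩ʳ x)) →
           φ ρ ≡ φ σ ∙F φ τ
    inj  : ∀ (σ τ : Aut F O) → φ σ ≡ φ τ → ∀ x → proj₁ σ ⟨$⟩ʳ x ≡ proj₁ τ ⟨$⟩ʳ x
    surj : ∀ (g : F21) → ∃ λ (σ : Aut F O) → φ σ ≡ g

{-# OPTIONS --safe #-}
-- Every pair of points lies on a cyclically oriented line, so ⇒ is a tournament, and condition (ii)
-- says that each out-neighbourhood is a line. Starting from a point x₀, its out-neighbours
-- x₁ ⇒ x₂ ⇒ x₄ and the third points x₃, x₆, x₅ of the lines through x₀, these two facts force every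
-- remaining arc: x_i ⇒ x_j iff j - i ∈ {1, 2, 4} in ℤ/7, i.e. the plane is the Paley tournament on ℤ/7,
-- whose lines are the out-neighbourhoods. An automorphism is thus a permutation of ℤ/7 preserving
-- the tournament. Such a map is determined by the image of the arc 0 ⇒ 1, since a + 2 is the only
-- common out-neighbour of a and a + 1; the 21 affine maps x ↦ 2 ^ k x + b preserve the tournament
-- and send 0 ⇒ 1 to each of the 21 arcs, so they are exactly the automorphisms.
module Submission where

open import Defs
open import Level using (0ℓ)
open import Data.Nat using (ℕ; _+_; _*_; _^_; _∸_)
import Data.Nat as ℕ
open import Data.Nat.Properties using (n<1+n)
open import Data.Nat.DivMod using (_mod_)
open import Data.Bool.Properties using () renaming (_≟_ to _≟ᵇ_)
open import Data.Empty using (⊥-elim)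
open import Data.Fin using (Fin; zero; suc; toℕ; _<_)
open import Data.Fin.Patterns using (0F; 1F; 2F; 3F; 4F; 5F; 6F)
open import Data.Fin.Properties using (_≟_; all?; any?; pigeonhole; <-irrefl)
open import Data.Fin.Subset using (Subset; ⁅_⁆; _∪_; _∈_; _⊆_; ∣_∣)
open import Data.Fin.Subset.Properties using (_∈?_; anySubset?; x∈⁅x⁆; x∈⁅y⁆⇒x≡y; x∈p∪q⁻; x∈p∪q⁺; ∪-comm; ∪-assoc; ⊆-antisym)
open import Data.Fin.Permutation using (Permutation′; _⟨$⟩ʳ_; _⟨$⟩ˡ_; permutation; inverseˡ; inverseʳ; flip)
open import Data.Vec using (lookup)
open import Data.Vec.Properties using (lookup∘tabulate; []=⇒lookup; lookup⇒[]=)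
import Data.Vec.Properties as Vec
open import Data.Product using (∃; ∃₂; _×_; _,_; proj₁; proj₂)
import Data.Product.Properties as Product
open import Data.Sum using (_⊎_; inj₁; inj₂; [_,_]; [_,_]′)
import Data.Sum as Sum
open import Function using (id; _∘_)
open import Function.Bundles using (mk⇔; Equivalence)
open import Relation.Nullary using (¬_; Dec; yes; no; ¬?; contradiction)
open import Relation.Nullary.Decidable using (from-yes; _→-dec_; _×-dec_; _⊎-dec_; map′; decidable-stable)
open import Relation.Unary using (Pred)
open import Relation.Binary.PropositionalEquality using (_≡_; _≢_; refl; sym; trans; cong; cong₂; subst; subst₂; module ≡-Reasoning)

open ≡-Reasoning

∈-triple₁ : ∀ a b c → a ∈ triple a b c
∈-triple₁ a b c = x∈p∪q⁺ (inj₁ (x∈⁅x⁆ a))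

∈-triple₂ : ∀ a b c → b ∈ triple a b c
∈-triple₂ a b c = x∈p∪q⁺ (inj₂ (x∈p∪q⁺ (inj₁ (x∈⁅x⁆ b))))

∈-triple₃ : ∀ a b c → c ∈ triple a b c
∈-triple₃ a b c = x∈p∪q⁺ (inj₂ (x∈p∪q⁺ (inj₂ (x∈⁅x⁆ c))))

∈-triple⁻ : ∀ {i} a b c → i ∈ triple a b c → i ≡ a ⊎ i ≡ b ⊎ i ≡ c
∈-triple⁻ a b c i∈ =
  Sum.map (x∈⁅y⁆⇒x≡y a) (Sum.map (x∈⁅y⁆⇒x≡y b) (x∈⁅y⁆⇒x≡y c) ∘ x∈p∪q⁻ _ _) (x∈p∪q⁻ _ _ i∈)

triple-swap₁₂ : ∀ a b c → triple a b c ≡ triple b a c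
triple-swap₁₂ a b c = begin
  ⁅ a ⁆ ∪ (⁅ b ⁆ ∪ ⁅ c ⁆)  ≡⟨ sym (∪-assoc ⁅ a ⁆ ⁅ b ⁆ ⁅ c ⁆) ⟩
  (⁅ a ⁆ ∪ ⁅ b ⁆) ∪ ⁅ c ⁆  ≡⟨ cong (_∪ ⁅ c ⁆) (∪-comm ⁅ a ⁆ ⁅ b ⁆) ⟩
  (⁅ b ⁆ ∪ ⁅ a ⁆) ∪ ⁅ c ⁆  ≡⟨ ∪-assoc ⁅ b ⁆ ⁅ a ⁆ ⁅ c ⁆ ⟩
  ⁅ b ⁆ ∪ (⁅ a ⁆ ∪ ⁅ c ⁆)  ∎

triple-swap₂₃ : ∀ a b c → triple a b c ≡ triple a c b
triple-swap₂₃ a b c = cong (⁅ a ⁆ ∪_) (∪-comm ⁅ b ⁆ ⁅ c ⁆)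

triple-⊆ : ∀ {a b c} {S : Subset 7} → a ∈ S → b ∈ S → c ∈ S → triple a b c ⊆ S
triple-⊆ {a} {b} {c} a∈S b∈S c∈S i∈ with ∈-triple⁻ a b c i∈
... | inj₁ refl = a∈S
... | inj₂ (inj₁ refl) = b∈S
... | inj₂ (inj₂ refl) = c∈S

∈-triple-map : ∀ (f : V → V) {i} a b c → i ∈ triple a b c → f i ∈ triple (f a) (f b) (f c)
∈-triple-map f a b c i∈ with ∈-triple⁻ a b c i∈
... | inj₁ refl = ∈-triple₁ _ _ _
... | inj₂ (inj₁ refl) = ∈-triple₂ _ _ _
... | inj₂ (inj₂ refl) = ∈-triple₃ _ _ _

_≟ₛ_ : (S T : Subset 7) → Dec (S ≡ T)
_≟ₛ_ = Vec.≡-dec _≟ᵇ_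

all-subsets? : {P : Pred (Subset 7) 0ℓ} → (∀ T → Dec (P T)) → Dec (∀ T → P T)
all-subsets? P? with anySubset? (¬? ∘ P?)
... | yes (T , ¬PT) = no λ ∀P → ¬PT (∀P T)
... | no ¬∃¬P = yes λ T → decidable-stable (P? T) (λ ¬PT → ¬∃¬P (T , ¬PT))

-- Checked by exhaustive search; opaque, as unfolding a search at a use site is very slow.
opaque
  triple-size⇒distinct : ∀ a b c → ∣ triple a b c ∣ ≡ 3 → a ≢ b × a ≢ c × b ≢ c
  triple-size⇒distinct = from-yes (all? λ (a : V) → all? λ (b : V) → all? λ (c : V) →
    (∣ triple a b c ∣ ℕ.≟ 3) →-dec ¬? (a ≟ b) ×-dec ¬? (a ≟ c) ×-dec ¬? (b ≟ c))

  size3⇒triple : ∀ T → ∣ T ∣ ≡ 3 → ∃ λ p → ∃₂ λ q r → T ≡ triple p q r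
  size3⇒triple = from-yes (all-subsets? λ T →
    (∣ T ∣ ℕ.≟ 3) →-dec any? λ (p : V) → any? λ (q : V) → any? λ (r : V) → T ≟ₛ triple p q r)

  size3⇒triple-through : ∀ T x y → ∣ T ∣ ≡ 3 → x ∈ T → y ∈ T → x ≢ y → ∃ λ z → T ≡ triple x y z
  size3⇒triple-through = from-yes (all-subsets? λ T → all? λ (x : V) → all? λ (y : V) →
    (∣ T ∣ ℕ.≟ 3) →-dec (x ∈? T) →-dec (y ∈? T) →-dec ¬? (x ≟ y) →-dec
    any? λ (z : V) → T ≟ₛ triple x y z)

  avoid : ∀ (a b c : V) → ∃ λ s → s ≢ a × s ≢ b × s ≢ c
  avoid = from-yes (all? λ (a : V) → all? λ (b : V) → all? λ (c : V) →
    any? λ (s : V) → ¬? (s ≟ a) ×-dec ¬? (s ≟ b) ×-dec ¬? (s ≟ c))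

injective⇒surjective : ∀ {n} (f : Fin n → Fin n) → (∀ {i j} → f i ≡ f j → i ≡ j) →
                       ∀ y → ∃ λ x → f x ≡ y
injective⇒surjective {n} f f-injective y with any? (λ x → f x ≟ y)
... | yes hit = hit
... | no miss = ⊥-elim (no-collision (pigeonhole (n<1+n n) y∷f))
  where
  y∷f : Fin (ℕ.suc n) → Fin n
  y∷f zero = y
  y∷f (suc i) = f i
  no-collision : ¬ ∃₂ λ i j → i < j × y∷f i ≡ y∷f j
  no-collision (zero , suc j , _ , y≡fj) = miss (j , sym y≡fj)
  no-collision (suc i , suc j , i<j , fi≡fj) = <-irrefl (cong suc (f-injective fi≡fj)) i<j

permute-≢ : ∀ {n} (π : Permutation′ n) {a b : Fin n} → a ≢ b → π ⟨$⟩ʳ a ≢ π ⟨$⟩ʳ b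
permute-≢ π a≢b e = a≢b (trans (sym (inverseˡ π)) (trans (cong (π ⟨$⟩ˡ_) e) (inverseˡ π)))

∈-image⁺ : (π : Permutation′ 7) {T : Subset 7} {i : V} → π ⟨$⟩ˡ i ∈ T → i ∈ image π T
∈-image⁺ π {T} {i} h = lookup⇒[]= i _ (trans (lookup∘tabulate (lookup T ∘ (π ⟨$⟩ˡ_)) i) ([]=⇒lookup h))

∈-image⁻ : (π : Permutation′ 7) {T : Subset 7} {i : V} → i ∈ image π T → π ⟨$⟩ˡ i ∈ T
∈-image⁻ π {T} {i} h = lookup⇒[]= _ T (trans (sym (lookup∘tabulate (lookup T ∘ (π ⟨$⟩ˡ_)) i)) ([]=⇒lookup h))

∈-image : (π : Permutation′ 7) {T : Subset 7} {x : V} → x ∈ T → π ⟨$⟩ʳ x ∈ image π T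
∈-image π {T} x∈T = ∈-image⁺ π (subst (_∈ T) (sym (inverseˡ π)) x∈T)

image-triple : (π : Permutation′ 7) (a b c : V) →
               image π (triple a b c) ≡ triple (π ⟨$⟩ʳ a) (π ⟨$⟩ʳ b) (π ⟨$⟩ʳ c)
image-triple π a b c = ⊆-antisym ⊆-triple (triple-⊆ (∈-image π (∈-triple₁ a b c))
                                                     (∈-image π (∈-triple₂ a b c))
                                                     (∈-image π (∈-triple₃ a b c)))
  where
  ⊆-triple : image π (triple a b c) ⊆ triple (π ⟨$⟩ʳ a) (π ⟨$⟩ʳ b) (π ⟨$⟩ʳ c)
  ⊆-triple i∈ = subst (_∈ _) (inverseʳ π) (∈-triple-map (π ⟨$⟩ʳ_) a b c (∈-image⁻ π i∈))

image-flip : (π : Permutation′ 7) (T : Subset 7) → image (flip π) (image π T) ≡ T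
image-flip π T = ⊆-antisym
  (λ i∈ → subst (_∈ T) (inverseˡ π) (∈-image⁻ π (∈-image⁻ (flip π) i∈)))
  (λ i∈ → ∈-image⁺ (flip π) (∈-image π i∈))

-- The Paley tournament on ℤ/7 and its affine automorphisms

_⊕_ : Fin 7 → ℕ → Fin 7
a ⊕ k = (toℕ a + k) mod 7

out : Fin 7 → Subset 7
out a = triple (a ⊕ 1) (a ⊕ 2) (a ⊕ 4)

-- A record rather than b ∈ out a, so that a and b can be inferred from a proof.
record _↝_ (a b : Fin 7) : Set where
  constructor arc
  field out-member : b ∈ out a

_↝?_ : ∀ a b → Dec (a ↝ b)
a ↝? b = map′ arc _↝_.out-member (b ∈? out a)

a↝a⊕1 : ∀ a → a ↝ (a ⊕ 1)
a↝a⊕1 a = arc (∈-triple₁ _ _ _)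

a↝a⊕2 : ∀ a → a ↝ (a ⊕ 2)
a↝a⊕2 a = arc (∈-triple₂ _ _ _)

↝-Hom : (Fin 7 → Fin 7) → Set
↝-Hom f = ∀ {a b} → a ↝ b → f a ↝ f b

aff : F21 → Fin 7 → Fin 7
aff (k , b) x = (2 ^ toℕ k * toℕ x + toℕ b) mod 7

-- x ↦ 2 ^ (3 ∸ k) * (x - b), as 2 ^ 3 ≡ 1 mod 7.
_⁻¹ : F21 → F21
(k , b) ⁻¹ = (3 ∸ toℕ k) mod 3 , ((7 ∸ toℕ b) * 2 ^ (3 ∸ toℕ k)) mod 7

-- 2 ^ log₂ d ≡ d for d ∈ {1, 2, 4}; 0F is a junk value elsewhere.
log₂ : Fin 7 → Fin 3
log₂ 2F = 1F
log₂ 4F = 2F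
log₂ _  = 0F

fromArc : Fin 7 → Fin 7 → F21
fromArc a b = log₂ ((7 + toℕ b ∸ toℕ a) mod 7) , a

all-F21? : {P : F21 → Set} → (∀ γ → Dec (P γ)) → Dec (∀ γ → P γ)
all-F21? P? = map′ (λ h (k , b) → h k b) (λ h k b → h (k , b))
                   (all? λ (k : Fin 3) → all? λ (b : Fin 7) → P? (k , b))

_≟F21_ : (γ δ : F21) → Dec (γ ≡ δ)
_≟F21_ = Product.≡-dec _≟_ _≟_

opaque
  aff-∙ : ∀ γ δ x → aff (γ ∙F δ) x ≡ aff γ (aff δ x)
  aff-∙ = from-yes (all-F21? λ γ → all-F21? λ δ → all? λ x → aff (γ ∙F δ) x ≟ aff γ (aff δ x))

  aff-inverseʳ : ∀ γ x → aff γ (aff (γ ⁻¹) x) ≡ x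
  aff-inverseʳ = from-yes (all-F21? λ γ → all? λ x → aff γ (aff (γ ⁻¹) x) ≟ x)

  aff-inverseˡ : ∀ γ x → aff (γ ⁻¹) (aff γ x) ≡ x
  aff-inverseˡ = from-yes (all-F21? λ γ → all? λ x → aff (γ ⁻¹) (aff γ x) ≟ x)

  aff-↝ : ∀ γ → ↝-Hom (aff γ)
  aff-↝ γ {a} {b} = from-yes (all-F21? λ γ → all? λ a → all? λ b →
    (a ↝? b) →-dec (aff γ a ↝? aff γ b)) γ a b

  fromArc-aff : ∀ γ → fromArc (aff γ 0F) (aff γ 1F) ≡ γ
  fromArc-aff = from-yes (all-F21? λ γ → fromArc (aff γ 0F) (aff γ 1F) ≟F21 γ)

  aff-fromArc : ∀ {a b} → a ↝ b → aff (fromArc a b) 0F ≡ a × aff (fromArc a b) 1F ≡ b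
  aff-fromArc {a} {b} = from-yes (all? λ a → all? λ b →
    (a ↝? b) →-dec (aff (fromArc a b) 0F ≟ a) ×-dec (aff (fromArc a b) 1F ≟ b)) a b

  ↝-tournament : ∀ a b → a ≢ b → a ↝ b ⊎ b ↝ a
  ↝-tournament = from-yes (all? λ a → all? λ b → ¬? (a ≟ b) →-dec ((a ↝? b) ⊎-dec (b ↝? a)))

  common-in-neighbour : ∀ a b → a ≢ b → ∃ λ j → j ↝ a × j ↝ b
  common-in-neighbour = from-yes (all? λ a → all? λ b → ¬? (a ≟ b) →-dec any? λ j → (j ↝? a) ×-dec (j ↝? b))

  common-out-neighbour-unique : ∀ {a b y z} → a ↝ b → a ↝ y → b ↝ y → a ↝ z → b ↝ z → y ≡ z
  common-out-neighbour-unique {a} {b} {y} {z} = from-yes (all? λ a → all? λ b → all? λ y → all? λ z →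
    (a ↝? b) →-dec (a ↝? y) →-dec (b ↝? y) →-dec (a ↝? z) →-dec (b ↝? z) →-dec (y ≟ z)) a b y z

  ⊕1↝⊕2 : ∀ a → (a ⊕ 1) ↝ (a ⊕ 2)
  ⊕1↝⊕2 = from-yes (all? λ a → (a ⊕ 1) ↝? (a ⊕ 2))

-- a ⊕ 2 is the only common out-neighbour of a and a ⊕ 1, so the values at 0 and 1 propagate.
↝-homs-agree : ∀ f g → ↝-Hom f → ↝-Hom g → f 0F ≡ g 0F → f 1F ≡ g 1F → ∀ x → f x ≡ g x
↝-homs-agree f g f-hom g-hom e₀ e₁ = λ where
    0F → e₀ ; 1F → e₁ ; 2F → e₂ ; 3F → e₃ ; 4F → e₄ ; 5F → e₅ ; 6F → e₆
  where
  step : ∀ a → f a ≡ g a → f (a ⊕ 1) ≡ g (a ⊕ 1) → f (a ⊕ 2) ≡ g (a ⊕ 2)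
  step a eₐ eₐ₊₁ = common-out-neighbour-unique
    (f-hom (a↝a⊕1 a)) (f-hom (a↝a⊕2 a)) (f-hom (⊕1↝⊕2 a))
    (subst (_↝ g (a ⊕ 2)) (sym eₐ) (g-hom (a↝a⊕2 a)))
    (subst (_↝ g (a ⊕ 2)) (sym eₐ₊₁) (g-hom (⊕1↝⊕2 a)))
  e₂ = step 0F e₀ e₁
  e₃ = step 1F e₁ e₂
  e₄ = step 2F e₂ e₃
  e₅ = step 3F e₃ e₄
  e₆ = step 4F e₄ e₅

-- Oriented Fano planes

module OrientedFano (F : FanoPlane) (O : Orientation F) where
  open FanoPlane F
  open Orientation O

  private variable
    a b c d p q r w x y z : V

  -- A record, so that the three points can be inferred from a proof.
  record Line (x y z : V) : Set where
    constructor line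
    field block : B (triple x y z)
  open Line

  Line-swap₁₂ : Line x y z → Line y x z
  Line-swap₁₂ {x} {y} {z} (line l) = line (subst B (triple-swap₁₂ x y z) l)

  Line-swap₂₃ : Line x y z → Line x z y
  Line-swap₂₃ {x} {y} {z} (line l) = line (subst B (triple-swap₂₃ x y z) l)

  Line-rotate : Line x y z → Line y z x
  Line-rotate = Line-swap₂₃ ∘ Line-swap₁₂

  Line-distinct : Line x y z → x ≢ y × x ≢ z × y ≢ z
  Line-distinct {x} {y} {z} (line l) = triple-size⇒distinct x y z (block-size (triple x y z) l)

  third : x ≢ y → ∃ (Line x y)
  third {x} {y} x≢y with pair-block x y x≢y
  ... | T , (T-block , x∈T , y∈T) , _ =
    let z , T≡xyz = size3⇒triple-through T x y (block-size T T-block) x∈T y∈T x≢y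
    in z , line (subst B T≡xyz T-block)

  third-unique : Line x y z → Line x y w → z ≡ w
  third-unique {x} {y} {z} {w} l@(line l₁) (line l₂) =
    let x≢y , x≢z , y≢z = Line-distinct l
        _ , _ , unique = pair-block x y x≢y
        xyz≡xyw = trans (sym (unique (l₁ , ∈-triple₁ x y z , ∈-triple₂ x y z)))
                        (unique (l₂ , ∈-triple₁ x y w , ∈-triple₂ x y w))
    in [ (λ z≡x → contradiction (sym z≡x) x≢z) , [ (λ z≡y → contradiction (sym z≡y) y≢z) , id ]′ ]′
         (∈-triple⁻ x y w (subst (z ∈_) xyz≡xyw (∈-triple₃ x y z)))

  thirds-distinct : Line x a c → Line x b d → a ≢ b → c ≢ d
  thirds-distinct lc ld a≢b refl = a≢b (third-unique (Line-swap₂₃ lc) (Line-swap₂₃ ld))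

  ⇒-Hom : (V → V) → Set
  ⇒-Hom f = ∀ {x y} → x ⇒ y → f x ⇒ f y

  ⇒-irrefl : ¬ (x ⇒ x)
  ⇒-irrefl {x} p = asym x x p p

  ⇒-distinct : x ⇒ y → x ≢ y
  ⇒-distinct p refl = ⇒-irrefl p

  out≢in : x ⇒ a → b ⇒ x → a ≢ b
  out≢in {x} x⇒a a⇒x refl = asym x _ x⇒a a⇒x

  Line-cycle : Line x y z → x ⇒ y → y ⇒ z × z ⇒ x
  Line-cycle {x} {y} {z} (line l) x⇒y =
    [ proj₂ , (λ (_ , _ , y⇒x) → contradiction y⇒x (asym x y x⇒y)) ] (cyclic x y z l)

  ⇒-total : x ≢ y → x ⇒ y ⊎ y ⇒ x
  ⇒-total {x} {y} x≢y =
    let z , line l = third x≢y in Sum.map proj₁ (proj₂ ∘ proj₂) (cyclic x y z l)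

  out-neighbour-on-line : y ⇒ x → ∃ λ z → Line x y z × x ⇒ z
  out-neighbour-on-line y⇒x =
    let z , l = third (⇒-distinct y⇒x) in z , Line-swap₁₂ l , proj₁ (Line-cycle l y⇒x)

  out-lines-distinct : x ⇒ a → x ⇒ b → a ≢ b → Line x a c → Line x b d → triple x a c ≢ triple x b d
  out-lines-distinct {x} {a} {b} {c} {d} x⇒a x⇒b a≢b la lb eq =
    [ ⇒-distinct x⇒b ∘ sym , [ a≢b ∘ sym , (λ { refl → asym x b x⇒b (proj₂ (Line-cycle la x⇒a)) }) ] ]
      (∈-triple⁻ x a c (subst (b ∈_) (sym eq) (∈-triple₂ x b d)))

  out-neighbours-line : x ⇒ a → x ⇒ b → x ⇒ c → a ≢ b → a ≢ c → b ≢ c → Line a b c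
  out-neighbours-line {x} {a} {b} {c} x⇒a x⇒b x⇒c a≢b a≢c b≢c =
    let a′ , la = third (⇒-distinct x⇒a)
        b′ , lb = third (⇒-distinct x⇒b)
        c′ , lc = third (⇒-distinct x⇒c)
    in line (out-block x a a′ b b′ c c′ (block la) (block lb) (block lc)
                       (out-lines-distinct x⇒a x⇒b a≢b la lb)
                       (out-lines-distinct x⇒a x⇒c a≢c la lc)
                       (out-lines-distinct x⇒b x⇒c b≢c lb lc)
                       x⇒a x⇒b x⇒c)

  -- a, b and d are out-neighbours of x, hence collinear.
  third-out-neighbour-unique : x ⇒ a → x ⇒ b → Line a b c → Line x c d → x ⇒ d → d ≡ c
  third-out-neighbour-unique {x} {a} {b} {c} {d} x⇒a x⇒b labc lxcd x⇒d =
    third-unique (out-neighbours-line x⇒a x⇒b x⇒d (proj₁ (Line-distinct labc)) a≢d b≢d) labc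
    where
    a≢d : a ≢ d
    a≢d refl = ⇒-distinct x⇒b (third-unique (Line-swap₁₂ (Line-rotate lxcd)) (Line-swap₂₃ labc))
    b≢d : b ≢ d
    b≢d refl = ⇒-distinct x⇒a (third-unique (Line-swap₁₂ (Line-rotate lxcd)) (Line-rotate labc))

  ⇒-third : x ⇒ a → x ⇒ b → Line a b c → x ⇒ c
  ⇒-third {x} {a} {b} {c} x⇒a x⇒b labc = [ id , if-c⇒x ]′ (⇒-total x≢c)
    where
    x≢c : x ≢ c
    x≢c refl = asym x b x⇒b (proj₂ (Line-cycle (Line-rotate (Line-rotate labc)) x⇒a))
    if-c⇒x : c ⇒ x → x ⇒ c
    if-c⇒x c⇒x =
      let d , lxcd , x⇒d = out-neighbour-on-line c⇒x
      in subst (x ⇒_) (third-out-neighbour-unique x⇒a x⇒b labc lxcd x⇒d) x⇒d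

  some-out-neighbour : ∀ x → ∃ (x ⇒_)
  some-out-neighbour x =
    let y , y≢x , _ = avoid x x x
    in [ (y ,_) , (λ y⇒x → let z , _ , x⇒z = out-neighbour-on-line y⇒x in z , x⇒z) ]′ (⇒-total (y≢x ∘ sym))

  another-out-neighbour : x ⇒ a → ∃ λ b → x ⇒ b × a ≢ b
  another-out-neighbour {x} {a} x⇒a =
    let a′ , la = third (⇒-distinct x⇒a)
        s , s≢x , s≢a , s≢a′ = avoid x a a′
    in [ (λ x⇒s → s , x⇒s , s≢a ∘ sym)
       , (λ s⇒x → let t , lxst , x⇒t = out-neighbour-on-line s⇒x
                  in t , x⇒t , λ a≡t → s≢a′ (third-unique (Line-swap₂₃ (subst (Line x s) (sym a≡t) lxst)) la))
       ]′ (⇒-total (s≢x ∘ sym))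

  -- The indices are residues mod 7, chosen so that eventually x_i ⇒ x_j iff j - i ∈ {1, 2, 4}.
  -- A frame records what is seen from x₀: its out-neighbours x₁ ⇒ x₂ ⇒ x₄ and its three lines.
  record Frame : Set where
    field
      x₀ x₁ x₂ x₃ x₄ x₅ x₆ : V
      x₀⇒x₁ : x₀ ⇒ x₁
      x₀⇒x₂ : x₀ ⇒ x₂
      x₁⇒x₂ : x₁ ⇒ x₂
      line₁₂₄ : Line x₁ x₂ x₄
      line₀₁₃ : Line x₀ x₁ x₃
      line₀₂₆ : Line x₀ x₂ x₆
      line₀₄₅ : Line x₀ x₄ x₅

  frame-from : x ⇒ a → x ⇒ b → a ⇒ b → Frame
  frame-from {x} {a} {b} x⇒a x⇒b a⇒b =
    let c , labc = third (⇒-distinct a⇒b)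
        a′ , la = third (⇒-distinct x⇒a)
        b′ , lb = third (⇒-distinct x⇒b)
        c′ , lc = third (⇒-distinct (⇒-third x⇒a x⇒b labc))
    in record { x₀ = x ; x₁ = a ; x₂ = b ; x₃ = a′ ; x₄ = c ; x₅ = c′ ; x₆ = b′
              ; x₀⇒x₁ = x⇒a ; x₀⇒x₂ = x⇒b ; x₁⇒x₂ = a⇒b
              ; line₁₂₄ = labc ; line₀₁₃ = la ; line₀₂₆ = lb ; line₀₄₅ = lc }

  frame : Frame
  frame =
    let a , o⇒a = some-out-neighbour 0F
        b , o⇒b , a≢b = another-out-neighbour o⇒a
    in [ frame-from o⇒a o⇒b , frame-from o⇒b o⇒a ]′ (⇒-total a≢b)

  module FrameArrows (f : Frame) where
    open Frame f

    x₀⇒x₄ : x₀ ⇒ x₄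
    x₀⇒x₄ = ⇒-third x₀⇒x₁ x₀⇒x₂ line₁₂₄

    x₂⇒x₄ : x₂ ⇒ x₄
    x₂⇒x₄ = proj₁ (Line-cycle line₁₂₄ x₁⇒x₂)

    x₄⇒x₁ : x₄ ⇒ x₁
    x₄⇒x₁ = proj₂ (Line-cycle line₁₂₄ x₁⇒x₂)

    x₁⇒x₃ : x₁ ⇒ x₃
    x₁⇒x₃ = proj₁ (Line-cycle line₀₁₃ x₀⇒x₁)

    x₃⇒x₀ : x₃ ⇒ x₀
    x₃⇒x₀ = proj₂ (Line-cycle line₀₁₃ x₀⇒x₁)

    x₂⇒x₆ : x₂ ⇒ x₆
    x₂⇒x₆ = proj₁ (Line-cycle line₀₂₆ x₀⇒x₂)

    x₆⇒x₀ : x₆ ⇒ x₀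
    x₆⇒x₀ = proj₂ (Line-cycle line₀₂₆ x₀⇒x₂)

    x₄⇒x₅ : x₄ ⇒ x₅
    x₄⇒x₅ = proj₁ (Line-cycle line₀₄₅ x₀⇒x₄)

    x₅⇒x₀ : x₅ ⇒ x₀
    x₅⇒x₀ = proj₂ (Line-cycle line₀₄₅ x₀⇒x₄)

  -- Multiplication of the indices by 2, a symmetry of the frame data.
  rotate : Frame → Frame
  rotate f = record
    { x₀ = x₀ ; x₁ = x₂ ; x₂ = x₄ ; x₃ = x₆ ; x₄ = x₁ ; x₅ = x₃ ; x₆ = x₅
    ; x₀⇒x₁ = x₀⇒x₂ ; x₀⇒x₂ = x₀⇒x₄ ; x₁⇒x₂ = x₂⇒x₄
    ; line₁₂₄ = Line-rotate line₁₂₄ ; line₀₁₃ = line₀₂₆ ; line₀₂₆ = line₀₄₅ ; line₀₄₅ = line₀₁₃ }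
    where open Frame f
          open FrameArrows f

  module _ (f : Frame) where
    open Frame f
    open FrameArrows f

    -- Otherwise x₅ ⇒ x₁, and however x₂ and x₅ are joined, the out-neighbours {x₀, x₁, x₂} of x₅
    -- or {x₄, x₅, x₆} of x₂ would form a line, clashing with a line through x₀.
    frame-x₁⇒x₅ : x₁ ⇒ x₅
    frame-x₁⇒x₅ = [ id , ⊥-elim ∘ not-x₅⇒x₁ ] (⇒-total (out≢in x₀⇒x₁ x₅⇒x₀))
      where
      not-x₅⇒x₁ : ¬ (x₅ ⇒ x₁)
      not-x₅⇒x₁ x₅⇒x₁ = [ not-x₅⇒x₂ , not-x₂⇒x₅ ] (⇒-total (out≢in x₀⇒x₂ x₅⇒x₀ ∘ sym))
        where
        not-x₅⇒x₂ : ¬ (x₅ ⇒ x₂)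
        not-x₅⇒x₂ x₅⇒x₂ = out≢in x₀⇒x₂ x₃⇒x₀ (third-unique
          (out-neighbours-line x₅⇒x₀ x₅⇒x₁ x₅⇒x₂ (⇒-distinct x₀⇒x₁) (⇒-distinct x₀⇒x₂) (⇒-distinct x₁⇒x₂))
          line₀₁₃)
        not-x₂⇒x₅ : ¬ (x₂ ⇒ x₅)
        not-x₂⇒x₅ x₂⇒x₅ = ⇒-distinct x₆⇒x₀ (third-unique
          (out-neighbours-line x₂⇒x₄ x₂⇒x₅ x₂⇒x₆ (⇒-distinct x₄⇒x₅) (out≢in x₀⇒x₄ x₆⇒x₀)
                               (thirds-distinct line₀₄₅ line₀₂₆ (⇒-distinct x₂⇒x₄ ∘ sym)))
          (Line-rotate line₀₄₅))

    frame-line₂₃₅ : Line x₂ x₃ x₅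
    frame-line₂₃₅ = out-neighbours-line x₁⇒x₂ x₁⇒x₃ frame-x₁⇒x₅
      (out≢in x₀⇒x₂ x₃⇒x₀) (out≢in x₀⇒x₂ x₅⇒x₀) (thirds-distinct line₀₁₃ line₀₄₅ (⇒-distinct x₄⇒x₁ ∘ sym))

  frame-cycle₂₃₅ : (f : Frame) → Frame.x₃ f ⇒ Frame.x₅ f × Frame.x₅ f ⇒ Frame.x₂ f
  frame-cycle₂₃₅ f = Line-cycle (frame-line₂₃₅ f) (frame-x₁⇒x₅ (rotate f))

  module _ (f : Frame) where
    open Frame f
    open FrameArrows f

    label : Fin 7 → V
    label 0F = x₀
    label 1F = x₁
    label 2F = x₂
    label 3F = x₃
    label 4F = x₄
    label 5F = x₅
    label 6F = x₆

    label-out : ∀ a → label a ⇒ label (a ⊕ 1) × label a ⇒ label (a ⊕ 2) × label a ⇒ label (a ⊕ 4)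
    label-out 0F = x₀⇒x₁ , x₀⇒x₂ , x₀⇒x₄
    label-out 1F = x₁⇒x₂ , x₁⇒x₃ , frame-x₁⇒x₅ f
    label-out 2F = frame-x₁⇒x₅ (rotate f) , x₂⇒x₄ , x₂⇒x₆
    label-out 3F = proj₂ (frame-cycle₂₃₅ (rotate f)) , proj₁ (frame-cycle₂₃₅ f) , x₃⇒x₀
    label-out 4F = x₄⇒x₅ , frame-x₁⇒x₅ (rotate (rotate f)) , x₄⇒x₁
    label-out 5F = proj₁ (frame-cycle₂₃₅ (rotate (rotate f))) , x₅⇒x₀ , proj₂ (frame-cycle₂₃₅ f)
    label-out 6F = x₆⇒x₀ , proj₂ (frame-cycle₂₃₅ (rotate (rotate f))) , proj₁ (frame-cycle₂₃₅ (rotate f))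

    label-hom : ∀ {a b} → a ↝ b → label a ⇒ label b
    label-hom {a} (arc b∈out) with ∈-triple⁻ (a ⊕ 1) (a ⊕ 2) (a ⊕ 4) b∈out
    ... | inj₁ refl = proj₁ (label-out a)
    ... | inj₂ (inj₁ refl) = proj₁ (proj₂ (label-out a))
    ... | inj₂ (inj₂ refl) = proj₂ (proj₂ (label-out a))

  module Labelled (ℓ : Fin 7 → V) (ℓ-hom : ∀ {a b} → a ↝ b → ℓ a ⇒ ℓ b) where

    ℓ-injective : ∀ {a b} → ℓ a ≡ ℓ b → a ≡ b
    ℓ-injective {a} {b} ℓa≡ℓb with a ≟ b
    ... | yes a≡b = a≡b
    ... | no a≢b = ⊥-elim ([ (λ a↝b → ⇒-distinct (ℓ-hom a↝b) ℓa≡ℓb)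
                           , (λ b↝a → ⇒-distinct (ℓ-hom b↝a) (sym ℓa≡ℓb)) ]′ (↝-tournament a b a≢b))

    ℓ⁻¹ : V → Fin 7
    ℓ⁻¹ y = proj₁ (injective⇒surjective ℓ ℓ-injective y)

    ℓ∘ℓ⁻¹ : ∀ y → ℓ (ℓ⁻¹ y) ≡ y
    ℓ∘ℓ⁻¹ y = proj₂ (injective⇒surjective ℓ ℓ-injective y)

    ℓ⁻¹∘ℓ : ∀ a → ℓ⁻¹ (ℓ a) ≡ a
    ℓ⁻¹∘ℓ a = ℓ-injective (ℓ∘ℓ⁻¹ (ℓ a))

    ℓ-reflects : ∀ {a b} → ℓ a ⇒ ℓ b → a ↝ b
    ℓ-reflects {a} {b} ℓa⇒ℓb with a ≟ b
    ... | yes refl = ⊥-elim (⇒-irrefl ℓa⇒ℓb)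
    ... | no a≢b = [ id , (λ b↝a → ⊥-elim (asym _ _ ℓa⇒ℓb (ℓ-hom b↝a))) ]′ (↝-tournament a b a≢b)

    ℓ⁻¹-hom : ∀ {x y} → x ⇒ y → ℓ⁻¹ x ↝ ℓ⁻¹ y
    ℓ⁻¹-hom {x} {y} x⇒y = ℓ-reflects (subst₂ _⇒_ (sym (ℓ∘ℓ⁻¹ x)) (sym (ℓ∘ℓ⁻¹ y)) x⇒y)

    -- x is a common in-neighbour of p and q, which exists in the Paley tournament.
    line-apex : Line p q r → ∃ λ x → x ⇒ p × x ⇒ q × x ⇒ r
    line-apex {p} {q} {r} lpqr =
      let j , j↝p , j↝q = common-in-neighbour (ℓ⁻¹ p) (ℓ⁻¹ q) (p≢q ∘ ℓ⁻¹-injective)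
          ℓj⇒p = subst (ℓ j ⇒_) (ℓ∘ℓ⁻¹ p) (ℓ-hom j↝p)
          ℓj⇒q = subst (ℓ j ⇒_) (ℓ∘ℓ⁻¹ q) (ℓ-hom j↝q)
      in ℓ j , ℓj⇒p , ℓj⇒q , ⇒-third ℓj⇒p ℓj⇒q lpqr
      where
      p≢q = proj₁ (Line-distinct lpqr)
      ℓ⁻¹-injective : ℓ⁻¹ p ≡ ℓ⁻¹ q → p ≡ q
      ℓ⁻¹-injective e = trans (sym (ℓ∘ℓ⁻¹ p)) (trans (cong ℓ e) (ℓ∘ℓ⁻¹ q))

    ⇒-hom-preserves-blocks : (π : Permutation′ 7) → ⇒-Hom (π ⟨$⟩ʳ_) → ∀ {T} → B T → B (image π T)
    ⇒-hom-preserves-blocks π π-hom {T} T-block =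
      let p , q , r , T≡pqr = size3⇒triple T (block-size T T-block)
          lpqr = line (subst B T≡pqr T-block)
          x , x⇒p , x⇒q , x⇒r = line-apex lpqr
          p≢q , p≢r , q≢r = Line-distinct lpqr
          lπ = out-neighbours-line (π-hom x⇒p) (π-hom x⇒q) (π-hom x⇒r)
                                   (permute-≢ π p≢q) (permute-≢ π p≢r) (permute-≢ π q≢r)
      in subst B (sym (trans (cong (image π) T≡pqr) (image-triple π p q r))) (block lπ)

    isAut-from-⇒-homs : (π : Permutation′ 7) → ⇒-Hom (π ⟨$⟩ʳ_) → ⇒-Hom (π ⟨$⟩ˡ_) → IsAut F O π
    isAut-from-⇒-homs π π-hom π⁻¹-hom =
      (λ T → mk⇔ (⇒-hom-preserves-blocks π π-hom)
                 (subst B (image-flip π T) ∘ ⇒-hom-preserves-blocks (flip π) π⁻¹-hom)) ,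
      (λ x y → mk⇔ π-hom (subst₂ _⇒_ (inverseˡ π) (inverseˡ π) ∘ π⁻¹-hom))

    relabel : Aut F O → Fin 7 → Fin 7
    relabel (σ , _) a = ℓ⁻¹ (σ ⟨$⟩ʳ ℓ a)

    relabel-hom : ∀ σ → ↝-Hom (relabel σ)
    relabel-hom (σ , _ , σ⇒) a↝b = ℓ⁻¹-hom (Equivalence.to (σ⇒ _ _) (ℓ-hom a↝b))

    φ : Aut F O → F21
    φ σ = fromArc (relabel σ 0F) (relabel σ 1F)

    relabel-affine : ∀ σ x → relabel σ x ≡ aff (φ σ) x
    relabel-affine σ =
      let e₀ , e₁ = aff-fromArc (relabel-hom σ (a↝a⊕1 0F))
      in ↝-homs-agree (relabel σ) (aff (φ σ)) (relabel-hom σ) (aff-↝ (φ σ)) (sym e₀) (sym e₁)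

    φ-hom : ∀ σ κ ρ → (∀ x → proj₁ ρ ⟨$⟩ʳ x ≡ proj₁ σ ⟨$⟩ʳ (proj₁ κ ⟨$⟩ʳ x)) → φ ρ ≡ φ σ ∙F φ κ
    φ-hom σ κ ρ ρ≡σκ = begin
      φ ρ                                                ≡⟨ cong₂ fromArc (relabel-ρ 0F) (relabel-ρ 1F) ⟩
      fromArc (aff (φ σ ∙F φ κ) 0F) (aff (φ σ ∙F φ κ) 1F) ≡⟨ fromArc-aff (φ σ ∙F φ κ) ⟩
      φ σ ∙F φ κ                                         ∎
      where
      relabel-ρ : ∀ x → relabel ρ x ≡ aff (φ σ ∙F φ κ) x
      relabel-ρ x = begin
        ℓ⁻¹ (proj₁ ρ ⟨$⟩ʳ ℓ x)                  ≡⟨ cong ℓ⁻¹ (ρ≡σκ (ℓ x)) ⟩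
        ℓ⁻¹ (proj₁ σ ⟨$⟩ʳ (proj₁ κ ⟨$⟩ʳ ℓ x))   ≡⟨ cong (λ y → ℓ⁻¹ (proj₁ σ ⟨$⟩ʳ y)) (sym (ℓ∘ℓ⁻¹ _)) ⟩
        relabel σ (relabel κ x)                ≡⟨ relabel-affine σ (relabel κ x) ⟩
        aff (φ σ) (relabel κ x)                ≡⟨ cong (aff (φ σ)) (relabel-affine κ x) ⟩
        aff (φ σ) (aff (φ κ) x)                ≡⟨ sym (aff-∙ (φ σ) (φ κ) x) ⟩
        aff (φ σ ∙F φ κ) x                     ∎

    φ-injective : ∀ σ κ → φ σ ≡ φ κ → ∀ x → proj₁ σ ⟨$⟩ʳ x ≡ proj₁ κ ⟨$⟩ʳ x
    φ-injective σ κ φσ≡φκ x = begin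
      proj₁ σ ⟨$⟩ʳ x                ≡⟨ sym (ℓ∘ℓ⁻¹ _) ⟩
      ℓ (ℓ⁻¹ (proj₁ σ ⟨$⟩ʳ x))      ≡⟨ cong (λ y → ℓ (ℓ⁻¹ (proj₁ σ ⟨$⟩ʳ y))) (sym (ℓ∘ℓ⁻¹ x)) ⟩
      ℓ (relabel σ (ℓ⁻¹ x))         ≡⟨ cong ℓ (relabel-affine σ (ℓ⁻¹ x)) ⟩
      ℓ (aff (φ σ) (ℓ⁻¹ x))         ≡⟨ cong (λ γ → ℓ (aff γ (ℓ⁻¹ x))) φσ≡φκ ⟩
      ℓ (aff (φ κ) (ℓ⁻¹ x))         ≡⟨ cong ℓ (sym (relabel-affine κ (ℓ⁻¹ x))) ⟩
      ℓ (relabel κ (ℓ⁻¹ x))         ≡⟨ cong (λ y → ℓ (ℓ⁻¹ (proj₁ κ ⟨$⟩ʳ y))) (ℓ∘ℓ⁻¹ x) ⟩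
      ℓ (ℓ⁻¹ (proj₁ κ ⟨$⟩ʳ x))      ≡⟨ ℓ∘ℓ⁻¹ _ ⟩
      proj₁ κ ⟨$⟩ʳ x                ∎

    transport : F21 → V → V
    transport γ = ℓ ∘ aff γ ∘ ℓ⁻¹

    transport-hom : ∀ γ → ⇒-Hom (transport γ)
    transport-hom γ = ℓ-hom ∘ aff-↝ γ ∘ ℓ⁻¹-hom

    transport-inverse : ∀ γ δ → (∀ a → aff γ (aff δ a) ≡ a) → ∀ y → transport γ (transport δ y) ≡ y
    transport-inverse γ δ γδ≡id y = begin
      ℓ (aff γ (ℓ⁻¹ (ℓ (aff δ (ℓ⁻¹ y)))))  ≡⟨ cong (ℓ ∘ aff γ) (ℓ⁻¹∘ℓ _) ⟩
      ℓ (aff γ (aff δ (ℓ⁻¹ y)))            ≡⟨ cong ℓ (γδ≡id _) ⟩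
      ℓ (ℓ⁻¹ y)                            ≡⟨ ℓ∘ℓ⁻¹ y ⟩
      y                                    ∎

    transported : F21 → Aut F O
    transported γ = π , isAut-from-⇒-homs π (transport-hom γ) (transport-hom (γ ⁻¹))
      where
      π = permutation (transport γ) (transport (γ ⁻¹))
                      (transport-inverse γ (γ ⁻¹) (aff-inverseʳ γ)) (transport-inverse (γ ⁻¹) γ (aff-inverseˡ γ))

    φ-surjective : ∀ γ → ∃ λ σ → φ σ ≡ γ
    φ-surjective γ = transported γ , (begin
      fromArc (relabel (transported γ) 0F) (relabel (transported γ) 1F)
        ≡⟨ cong₂ fromArc (relabel-transported 0F) (relabel-transported 1F) ⟩
      fromArc (aff γ 0F) (aff γ 1F)
        ≡⟨ fromArc-aff γ ⟩
      γ ∎)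
      where
      relabel-transported : ∀ a → relabel (transported γ) a ≡ aff γ a
      relabel-transported a = trans (ℓ⁻¹∘ℓ _) (cong (aff γ) (ℓ⁻¹∘ℓ a))

theorem3p6 : (F : FanoPlane) (O : Orientation F) → AutIsoF21 F O
theorem3p6 F O = record { φ = φ ; hom = φ-hom ; inj = φ-injective ; surj = φ-surjective }
  where
  open OrientedFano F O
  open Labelled (label frame) (label-hom frame)
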